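{- For a finite simple graph $G$ the following are equivalent: (i) $G$ is a König–Egerváry graph; (ii) for every $S_1,S_2\in\Omega(G)$, the set $S_1\cup S_2$ is critical; (iii) there exist $S_1,S_2\in\Omega(G)$ such that $S_1\cup S_2$ is critical.
   Context: For $X\subseteq V(G)$, $N(X)$ is the set of vertices adjacent to some vertex of $X$, $d(X)=|X|-|N(X)|$, $d(G)=\max\{d(X):X\subseteq V(G)\}$, and $X$ is critical if $d(X)=d(G)$. $\Omega(G)$ is the family of maximum independent sets; $\alpha(G)$ the independence number; $\mu(G)$ the matching number. $G$ is König–Egerváry if $\alpha(G)+\mu(G)=|V(G)|$. -}

module Defs where

open import Data.Nat using (ℕ; zero; suc; _+_; _≤_)
open import Data.Bool using (Bool; true; false; _∧_; _∨_)
open import Data.Fin using (Fin; zero; suc)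
open import Data.Fin.Subset using (Subset; _∈_; ∣_∣)
open import Data.Vec using (tabulate; lookup)
open import Data.List using (List; length; concatMap; _∷_; [])
open import Data.List.Relation.Unary.All using (All)
open import Data.List.Relation.Unary.Unique.Propositional using (Unique)
open import Data.Product using (Σ; _×_; _,_)
open import Data.Integer as ℤ using (ℤ; +_)
open import Relation.Binary.PropositionalEquality using (_≡_)

record Graph (n : ℕ) : Set where
  field
    adj     : Fin n → Fin n → Bool
    adj-sym : ∀ u v → adj u v ≡ adj v u
    adj-irr : ∀ v → adj v v ≡ false
open Graph public

anyFin : ∀ {m} → (Fin m → Bool) → Bool
anyFin {zero}  p = false
anyFin {suc m} p = p zero ∨ anyFin (λ i → p (suc i))

module _ {n : ℕ} (G : Graph n) where

  N : Subset n → Subset n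
  N X = tabulate (λ v → anyFin (λ u → lookup X u ∧ adj G u v))

  d : Subset n → ℤ
  d X = + ∣ X ∣ ℤ.- + ∣ N X ∣

  -- X is critical iff d(X) = d(G) = max_Y d(Y), i.e. d(X) attains the maximum
  Critical : Subset n → Set
  Critical X = ∀ Y → d Y ℤ.≤ d X

  Independent : Subset n → Set
  Independent S = ∀ u v → u ∈ S → v ∈ S → adj G u v ≡ false

  MaxIndependent : Subset n → Set
  MaxIndependent S = Independent S × (∀ T → Independent T → ∣ T ∣ ≤ ∣ S ∣)

  endpoints : List (Fin n × Fin n) → List (Fin n)
  endpoints = concatMap (λ { (u , v) → u ∷ v ∷ [] })

  Matching : List (Fin n × Fin n) → Set
  Matching M = All (λ { (u , v) → adj G u v ≡ true }) M × Unique (endpoints M)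

  MaxMatching : List (Fin n × Fin n) → Set
  MaxMatching M = Matching M × (∀ M' → Matching M' → length M' ≤ length M)

  KonigEgervary : Set
  KonigEgervary =
    Σ (Subset n) λ S → Σ (List (Fin n × Fin n)) λ M →
      MaxIndependent S × MaxMatching M × (∣ S ∣ + length M ≡ n)

-- A maximum independent set S is dominating, so N(S) = V ∖ S and d(S) = 2α − n; likewise
-- N(S₁ ∪ S₂) = V ∖ (S₁ ∩ S₂) for S₁, S₂ ∈ Ω, whence d(S₁ ∪ S₂) = d(S₁) and S₁ ∪ S₂ is critical
-- iff S₁ is. For any matching M and any X, d(X) ≤ n − 2|M|, so in a König–Egerváry graph
-- d(X) ≤ n − 2μ = 2α − n = d(S). Conversely, if S ∈ Ω is critical, Hall's condition holds for
-- matching V ∖ S into S; Hall's theorem yields a matching of size n − α, and no matching is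
-- larger because every edge has an endpoint outside S.

module Submission where

open import Defs

open import Data.Bool using (Bool; true; false; _∧_; _∨_; not)
import Data.Bool.Properties as Boolₚ
open import Data.Bool.Properties
  using (∧-inverseˡ; ∧-inverseʳ; ∨-inverseʳ; ∧-zeroʳ; ∨-zeroʳ; ∧-identityʳ; ∧-distribˡ-∨; ∧-conicalˡ; ∧-conicalʳ)
open import Data.Empty using (⊥; ⊥-elim)
open import Data.Fin using (Fin; zero; suc)
open import Data.Fin.Properties using (_≟_; all?)
open import Data.Fin.Subset using (Subset; _∪_; ∣_∣; _∈_; _⊂_; ⁅_⁆) renaming (⊥ to ∅)
open import Data.Fin.Subset.Properties
  using (p⊂q⇒∣p∣<∣q∣; p⊆p∪q; x∈p∪q⁺; x∈p∪q⁻; x∈⁅x⁆; x∈⁅y⁆⇒x≡y; ∉⊥; ∣p∣≤n; anySubset?; _∈?_)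
open import Data.Integer as ℤ using (_⊖_)
import Data.Integer.Properties as ℤₚ
open import Data.List as List using (List; []; _∷_; length)
open import Data.List.Properties using (concatMap-++; length-++)
open import Data.List.Relation.Unary.All as All using (All; []; _∷_)
import Data.List.Relation.Unary.All.Properties as Allₚ
open import Data.List.Relation.Unary.AllPairs using ([]; _∷_)
open import Data.List.Relation.Unary.Unique.Propositional using (Unique)
import Data.List.Relation.Unary.Unique.Propositional.Properties as Uniqueₚ
open import Data.Nat as ℕ using (ℕ; zero; suc; _+_; _≤_; _<_; z≤n; s≤s; s≤s⁻¹; _<?_; _≤?_)
open import Data.Nat.Induction using (<-wellFounded)
import Data.Nat.ListAction as ListAction
open import Data.Nat.Properties
  using ( ≤-refl; ≤-reflexive; ≤-trans; ≤-antisym; ≮⇒≥; <⇒≱; ≰⇒>; n≢0⇒n>0; m≤m+n; m≤n+m; m<n+m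
        ; +-comm; +-assoc; +-suc; +-identityʳ; +-mono-≤; +-monoˡ-≤; +-monoʳ-≤
        ; +-cancelʳ-≡; +-cancelˡ-≤; +-cancelʳ-≤; +-commutativeSemigroup; +-0-commutativeMonoid
        ; module ≤-Reasoning)
open import Data.Nat.Tactic.RingSolver using (solve-∀)
open import Data.Product using (Σ; _×_; ∃; _,_; proj₁)
open import Data.Sum using (_⊎_; inj₁; inj₂)
open import Data.Vec using ([]; _∷_; lookup; tabulate)
open import Data.Vec.Functional using (Vector)
open import Data.Vec.Properties using (lookup∘tabulate; lookup-zipWith; lookup⇒[]=; []=⇒lookup)
open import Function using (_∘_; _⇔_; mk⇔; Equivalence; case_of_)
open import Induction.WellFounded using (Acc; acc)
open import Relation.Binary.PropositionalEquality
  using (_≡_; _≢_; _≗_; refl; sym; trans; cong; cong₂; subst; subst₂; module ≡-Reasoning)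
open import Relation.Nullary using (Dec; does; yes; no; ¬_)
open import Relation.Nullary.Decidable using (_×-dec_; _→-dec_)

open import Algebra.Lattice.Properties.BooleanAlgebra Boolₚ.∨-∧-booleanAlgebra using (deMorgan₁)
open import Algebra.Properties.CommutativeMonoid.Sum +-0-commutativeMonoid using (sum; sum-cong-≗; ∑-distrib-+)
open import Algebra.Properties.CommutativeSemigroup +-commutativeSemigroup
  using (interchange; x∙yz≈y∙xz; xy∙z≈yz∙x)

-- Set operations on these compute pointwise; a Subset X corresponds to lookup X.
Subsetᶠ : ℕ → Set
Subsetᶠ = Vector Bool

private variable
  n : ℕ
  a : Fin n
  A B C : Subsetᶠ n

module _ {n : ℕ} where

  infix  4 _∈ᶠ_ _⊆ᶠ_
  infixr 7 _∩ᶠ_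
  infixl 7 _─ᶠ_
  infixr 6 _∪ᶠ_

  _∈ᶠ_ : Fin n → Subsetᶠ n → Set
  i ∈ᶠ A = A i ≡ true

  _⊆ᶠ_ : Subsetᶠ n → Subsetᶠ n → Set
  A ⊆ᶠ B = ∀ i → i ∈ᶠ A → i ∈ᶠ B

  Disjointᶠ : Subsetᶠ n → Subsetᶠ n → Set
  Disjointᶠ A B = ∀ i → A i ∧ B i ≡ false

  ∅ᶠ ⊤ᶠ : Subsetᶠ n
  ∅ᶠ _ = false
  ⊤ᶠ _ = true

  ⁅_⁆ᶠ : Fin n → Subsetᶠ n
  ⁅ a ⁆ᶠ i = does (i ≟ a)

  ∁ᶠ : Subsetᶠ n → Subsetᶠ n
  ∁ᶠ A i = not (A i)

  _∩ᶠ_ _∪ᶠ_ _─ᶠ_ : Subsetᶠ n → Subsetᶠ n → Subsetᶠ n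
  (A ∩ᶠ B) i = A i ∧ B i
  (A ∪ᶠ B) i = A i ∨ B i
  (A ─ᶠ B) i = A i ∧ not (B i)

∨-true⁻ : ∀ x {y} → x ∨ y ≡ true → x ≡ true ⊎ y ≡ true
∨-true⁻ true  _   = inj₁ refl
∨-true⁻ false x∨y = inj₂ x∨y

≗⇒⊆ᶠ : A ≗ B → A ⊆ᶠ B
≗⇒⊆ᶠ A≗B i i∈A = trans (sym (A≗B i)) i∈A

⊆ᶠ-antisym : A ⊆ᶠ B → B ⊆ᶠ A → A ≗ B
⊆ᶠ-antisym {A = A} {B} A⊆B B⊆A i with A i in Aᵢ | B i in Bᵢ
... | true  | true  = refl
... | false | false = refl
... | true  | false = trans (sym (A⊆B i Aᵢ)) Bᵢ
... | false | true  = trans (sym Aᵢ) (B⊆A i Bᵢ)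

⊆ᶠ-trans : A ⊆ᶠ B → B ⊆ᶠ C → A ⊆ᶠ C
⊆ᶠ-trans A⊆B B⊆C i = B⊆C i ∘ A⊆B i

∩ᶠ-⊆ˡ : ∀ (A B : Subsetᶠ n) → A ∩ᶠ B ⊆ᶠ A
∩ᶠ-⊆ˡ A B i = ∧-conicalˡ (A i) (B i)

∩ᶠ-⊆ʳ : ∀ (A B : Subsetᶠ n) → A ∩ᶠ B ⊆ᶠ B
∩ᶠ-⊆ʳ A B i = ∧-conicalʳ (A i) (B i)

∩ᶠ-intro : ∀ {i} → i ∈ᶠ A → i ∈ᶠ B → i ∈ᶠ A ∩ᶠ B
∩ᶠ-intro i∈A i∈B rewrite i∈A = i∈B

─ᶠ-⊆ : ∀ (A B : Subsetᶠ n) → A ─ᶠ B ⊆ᶠ A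
─ᶠ-⊆ A B i = ∧-conicalˡ (A i) (not (B i))

⊆-∪ᶠˡ : A ⊆ᶠ A ∪ᶠ B
⊆-∪ᶠˡ _ i∈A rewrite i∈A = refl

⊆-∪ᶠʳ : B ⊆ᶠ A ∪ᶠ B
⊆-∪ᶠʳ {A = A} i i∈B rewrite i∈B = ∨-zeroʳ (A i)

∪ᶠ-⊆ : A ⊆ᶠ C → B ⊆ᶠ C → A ∪ᶠ B ⊆ᶠ C
∪ᶠ-⊆ {A = A} A⊆C B⊆C i i∈A∪B with ∨-true⁻ (A i) i∈A∪B
... | inj₁ i∈A = A⊆C i i∈A
... | inj₂ i∈B = B⊆C i i∈B

∈─ᶠ⇒∉ : ∀ {i} → i ∈ᶠ A ─ᶠ B → i ∈ᶠ B → ⊥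
∈─ᶠ⇒∉ {A = A} {B} {i} i∈A─B i∈B = case trans (sym i∈A─B) (trans (cong (λ x → A i ∧ not x) i∈B) (∧-zeroʳ (A i))) of λ ()

∉ᶠ⇒false : ∀ {i} → (i ∈ᶠ A → ⊥) → A i ≡ false
∉ᶠ⇒false {A = A} {i} i∉A with A i
... | true  = ⊥-elim (i∉A refl)
... | false = refl

Disjointᶠ-intro : (∀ i → i ∈ᶠ A → i ∈ᶠ B → ⊥) → Disjointᶠ A B
Disjointᶠ-intro {A = A} {B} ∉both i with A i in Aᵢ | B i in Bᵢ
... | false | _     = refl
... | true  | false = refl
... | true  | true  = ⊥-elim (∉both i Aᵢ Bᵢ)

Disjointᶠ-elim : Disjointᶠ A B → ∀ i → i ∈ᶠ A → i ∈ᶠ B → ⊥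
Disjointᶠ-elim A∩B≗∅ i i∈A i∈B = case trans (sym (A∩B≗∅ i)) (cong₂ _∧_ i∈A i∈B) of λ ()

Disjointᶠ-mono : ∀ {A′ B′ : Subsetᶠ n} → A′ ⊆ᶠ A → B′ ⊆ᶠ B → Disjointᶠ A B → Disjointᶠ A′ B′
Disjointᶠ-mono {A = A} {B} {A′} {B′} A′⊆A B′⊆B A∩B≗∅ = Disjointᶠ-intro {A = A′} {B′} λ i i∈A′ i∈B′ →
  Disjointᶠ-elim {A = A} {B} A∩B≗∅ i (A′⊆A i i∈A′) (B′⊆B i i∈B′)

x∈⁅x⁆ᶠ : ∀ (a : Fin n) → a ∈ᶠ ⁅ a ⁆ᶠ
x∈⁅x⁆ᶠ a with a ≟ a
... | yes _  = refl
... | no a≢a = ⊥-elim (a≢a refl)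

x∈⁅y⁆ᶠ⇒x≡y : ∀ {i} → i ∈ᶠ ⁅ a ⁆ᶠ → i ≡ a
x∈⁅y⁆ᶠ⇒x≡y {a = a} {i} i∈⁅a⁆ with i ≟ a
... | yes i≡a = i≡a

⁅⁆ᶠ-⊆ : a ∈ᶠ A → ⁅ a ⁆ᶠ ⊆ᶠ A
⁅⁆ᶠ-⊆ {A = A} a∈A i i∈⁅a⁆ = subst (_∈ᶠ A) (sym (x∈⁅y⁆ᶠ⇒x≡y i∈⁅a⁆)) a∈A

All∈ᶠ⇒fresh : ∀ {xs} → All (_∈ᶠ A) xs → A a ≡ false → All (a ≢_) xs
All∈ᶠ⇒fresh {A = A} xs⊆A Aa = All.map (λ {x} x∈A a≡x → case trans (sym Aa) (subst (λ z → A z ≡ true) (sym a≡x) x∈A) of λ ()) xs⊆A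

lookup-∪ : ∀ (X Y : Subset n) → lookup (X ∪ Y) ≗ lookup X ∪ᶠ lookup Y
lookup-∪ X Y i = lookup-zipWith _∨_ i X Y

⟦_⟧ : Bool → ℕ
⟦ true  ⟧ = 1
⟦ false ⟧ = 0

∣_∣ᶠ : ∀ {n} → Subsetᶠ n → ℕ
∣ A ∣ᶠ = sum (⟦_⟧ ∘ A)

sum-mono-≤ : {f g : Vector ℕ n} → (∀ i → f i ≤ g i) → sum f ≤ sum g
sum-mono-≤ {zero}  f≤g = z≤n
sum-mono-≤ {suc n} f≤g = +-mono-≤ (f≤g zero) (sum-mono-≤ (f≤g ∘ suc))

⟦⟧-mono : ∀ {x y} → (x ≡ true → y ≡ true) → ⟦ x ⟧ ≤ ⟦ y ⟧
⟦⟧-mono {false} _   = z≤n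
⟦⟧-mono {true}  x⇒y rewrite x⇒y refl = ≤-refl

⟦∨⟧+⟦∧⟧ : ∀ x y → ⟦ x ∨ y ⟧ + ⟦ x ∧ y ⟧ ≡ ⟦ x ⟧ + ⟦ y ⟧
⟦∨⟧+⟦∧⟧ true  true  = refl
⟦∨⟧+⟦∧⟧ true  false = refl
⟦∨⟧+⟦∧⟧ false true  = refl
⟦∨⟧+⟦∧⟧ false false = refl

∣∣ᶠ-cong : A ≗ B → ∣ A ∣ᶠ ≡ ∣ B ∣ᶠ
∣∣ᶠ-cong A≗B = sum-cong-≗ (cong ⟦_⟧ ∘ A≗B)

∣∣ᶠ-mono : A ⊆ᶠ B → ∣ A ∣ᶠ ≤ ∣ B ∣ᶠ
∣∣ᶠ-mono A⊆B = sum-mono-≤ (⟦⟧-mono ∘ A⊆B)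

∣∅∣ᶠ : ∀ n → ∣ ∅ᶠ {n} ∣ᶠ ≡ 0
∣∅∣ᶠ zero    = refl
∣∅∣ᶠ (suc n) = ∣∅∣ᶠ n

∣⊤∣ᶠ : ∀ n → ∣ ⊤ᶠ {n} ∣ᶠ ≡ n
∣⊤∣ᶠ zero    = refl
∣⊤∣ᶠ (suc n) = cong suc (∣⊤∣ᶠ n)

∣∪∣ᶠ+∣∩∣ᶠ : ∀ (A B : Subsetᶠ n) → ∣ A ∪ᶠ B ∣ᶠ + ∣ A ∩ᶠ B ∣ᶠ ≡ ∣ A ∣ᶠ + ∣ B ∣ᶠ
∣∪∣ᶠ+∣∩∣ᶠ A B = begin
  ∣ A ∪ᶠ B ∣ᶠ + ∣ A ∩ᶠ B ∣ᶠ          ≡⟨ ∑-distrib-+ (⟦_⟧ ∘ (A ∪ᶠ B)) (⟦_⟧ ∘ (A ∩ᶠ B)) ⟨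
  sum (λ i → ⟦ A i ∨ B i ⟧ + ⟦ A i ∧ B i ⟧) ≡⟨ sum-cong-≗ (λ i → ⟦∨⟧+⟦∧⟧ (A i) (B i)) ⟩
  sum (λ i → ⟦ A i ⟧ + ⟦ B i ⟧)            ≡⟨ ∑-distrib-+ (⟦_⟧ ∘ A) (⟦_⟧ ∘ B) ⟩
  ∣ A ∣ᶠ + ∣ B ∣ᶠ                         ∎
  where open ≡-Reasoning

∣∪∣ᶠ-disjoint : Disjointᶠ A B → ∣ A ∪ᶠ B ∣ᶠ ≡ ∣ A ∣ᶠ + ∣ B ∣ᶠ
∣∪∣ᶠ-disjoint {n} {A} {B} A∩B≗∅ = begin
  ∣ A ∪ᶠ B ∣ᶠ                ≡⟨ +-identityʳ _ ⟨
  ∣ A ∪ᶠ B ∣ᶠ + 0            ≡⟨ cong (∣ A ∪ᶠ B ∣ᶠ +_) (trans (∣∣ᶠ-cong {A = A ∩ᶠ B} {∅ᶠ} A∩B≗∅) (∣∅∣ᶠ n)) ⟨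
  ∣ A ∪ᶠ B ∣ᶠ + ∣ A ∩ᶠ B ∣ᶠ  ≡⟨ ∣∪∣ᶠ+∣∩∣ᶠ A B ⟩
  ∣ A ∣ᶠ + ∣ B ∣ᶠ            ∎
  where open ≡-Reasoning

∣∣ᶠ-union-bound : A ⊆ᶠ B ∪ᶠ C → ∣ A ∣ᶠ ≤ ∣ B ∣ᶠ + ∣ C ∣ᶠ
∣∣ᶠ-union-bound {B = B} {C} A⊆B∪C = begin
  _                          ≤⟨ ∣∣ᶠ-mono A⊆B∪C ⟩
  ∣ B ∪ᶠ C ∣ᶠ                ≤⟨ m≤m+n _ _ ⟩
  ∣ B ∪ᶠ C ∣ᶠ + ∣ B ∩ᶠ C ∣ᶠ  ≡⟨ ∣∪∣ᶠ+∣∩∣ᶠ B C ⟩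
  ∣ B ∣ᶠ + ∣ C ∣ᶠ            ∎
  where open ≤-Reasoning

∣∣ᶠ-partition : ∀ (A C : Subsetᶠ n) → ∣ A ∣ᶠ ≡ ∣ A ∩ᶠ C ∣ᶠ + ∣ A ─ᶠ C ∣ᶠ
∣∣ᶠ-partition A C = trans (∣∣ᶠ-cong (λ i → split (A i) (C i))) (∣∪∣ᶠ-disjoint (λ i → disjoint (A i) (C i)))
  where
  split : ∀ x c → x ≡ (x ∧ c) ∨ (x ∧ not c)
  split false c     = refl
  split true  true  = refl
  split true  false = refl
  disjoint : ∀ x c → (x ∧ c) ∧ (x ∧ not c) ≡ false
  disjoint false c     = refl
  disjoint true  true  = refl
  disjoint true  false = refl

∣∣ᶠ-⊆-partition : B ⊆ᶠ A → ∣ A ∣ᶠ ≡ ∣ B ∣ᶠ + ∣ A ─ᶠ B ∣ᶠ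
∣∣ᶠ-⊆-partition {B = B} {A} B⊆A =
  trans (∣∣ᶠ-partition A B) (cong (_+ ∣ A ─ᶠ B ∣ᶠ) (∣∣ᶠ-cong (⊆ᶠ-antisym (∩ᶠ-⊆ʳ A B) (λ i i∈B → ∩ᶠ-intro {A = A} {B} (B⊆A i i∈B) i∈B))))

∣∣ᶠ+∣∁∣ᶠ : ∀ (A : Subsetᶠ n) → ∣ A ∣ᶠ + ∣ ∁ᶠ A ∣ᶠ ≡ n
∣∣ᶠ+∣∁∣ᶠ {n} A = begin
  ∣ A ∣ᶠ + ∣ ∁ᶠ A ∣ᶠ  ≡⟨ ∣∪∣ᶠ-disjoint {n} {A} {∁ᶠ A} (λ i → ∧-inverseʳ (A i)) ⟨
  ∣ A ∪ᶠ ∁ᶠ A ∣ᶠ      ≡⟨ ∣∣ᶠ-cong {A = A ∪ᶠ ∁ᶠ A} {⊤ᶠ {n}} (λ i → ∨-inverseʳ (A i)) ⟩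
  ∣ ⊤ᶠ {n} ∣ᶠ         ≡⟨ ∣⊤∣ᶠ n ⟩
  n                   ∎
  where open ≡-Reasoning

∣∩⁅⁆∣ᶠ : ∀ (A : Subsetᶠ n) a → ∣ A ∩ᶠ ⁅ a ⁆ᶠ ∣ᶠ ≡ ⟦ A a ⟧
∣∩⁅⁆∣ᶠ {suc n} A zero    = trans (cong (⟦ A zero ∧ true ⟧ +_) (trans (∣∣ᶠ-cong {B = ∅ᶠ} (λ i → ∧-zeroʳ (A (suc i)))) (∣∅∣ᶠ n)))
                                 (trans (+-identityʳ _) (cong ⟦_⟧ (∧-identityʳ (A zero))))
∣∩⁅⁆∣ᶠ {suc n} A (suc a) = trans (cong (λ x → ⟦ x ⟧ + ∣ (A ∘ suc) ∩ᶠ ⁅ a ⁆ᶠ ∣ᶠ) (∧-zeroʳ (A zero))) (∣∩⁅⁆∣ᶠ (A ∘ suc) a)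

∣∣ᶠ-remove : a ∈ᶠ A → ∣ A ∣ᶠ ≡ suc ∣ A ─ᶠ ⁅ a ⁆ᶠ ∣ᶠ
∣∣ᶠ-remove {a = a} {A} a∈A =
  trans (∣∣ᶠ-partition A ⁅ a ⁆ᶠ) (cong (_+ ∣ A ─ᶠ ⁅ a ⁆ᶠ ∣ᶠ) (trans (∣∩⁅⁆∣ᶠ A a) (cong ⟦_⟧ a∈A)))

∣∣ᶠ-nonempty : ∀ (A : Subsetᶠ n) → 0 < ∣ A ∣ᶠ → ∃ λ i → i ∈ᶠ A
∣∣ᶠ-nonempty {suc n} A pos with A zero in A₀
... | true  = zero , A₀
... | false = let i , i∈A = ∣∣ᶠ-nonempty (A ∘ suc) pos in suc i , i∈A

∣∣≡∣lookup∣ᶠ : ∀ (X : Subset n) → ∣ X ∣ ≡ ∣ lookup X ∣ᶠ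
∣∣≡∣lookup∣ᶠ []          = refl
∣∣≡∣lookup∣ᶠ (true ∷ X)  = cong suc (∣∣≡∣lookup∣ᶠ X)
∣∣≡∣lookup∣ᶠ (false ∷ X) = ∣∣≡∣lookup∣ᶠ X

module _ {n : ℕ} where

  open import Data.List.Membership.DecPropositional (_≟_ {n}) using () renaming (_∈?_ to _∈ₗ?_)

  ⟨_⟩ᶠ : List (Fin n) → Subsetᶠ n
  ⟨ xs ⟩ᶠ i = does (i ∈ₗ? xs)

  ⁅⁆-⟨⟩-disjoint : ∀ {x xs} → All (x ≢_) xs → Disjointᶠ ⁅ x ⁆ᶠ ⟨ xs ⟩ᶠ
  ⁅⁆-⟨⟩-disjoint {x} {xs} x∉xs i with i ≟ x
  ... | no _     = refl
  ... | yes refl with x ∈ₗ? xs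
  ...   | no _     = refl
  ...   | yes x∈xs = ⊥-elim (All.lookup x∉xs x∈xs refl)

  count : Subsetᶠ n → List (Fin n) → ℕ
  count A xs = ListAction.sum (List.map (⟦_⟧ ∘ A) xs)

  ∣∩⟨⟩∣ᶠ : ∀ (A : Subsetᶠ n) {xs} → Unique xs → ∣ A ∩ᶠ ⟨ xs ⟩ᶠ ∣ᶠ ≡ count A xs
  ∣∩⟨⟩∣ᶠ A {[]}     []             = trans (∣∣ᶠ-cong {B = ∅ᶠ} (λ i → ∧-zeroʳ (A i))) (∣∅∣ᶠ n)
  ∣∩⟨⟩∣ᶠ A {x ∷ xs} (x∉xs ∷ xs!) = begin
    ∣ A ∩ᶠ ⟨ x ∷ xs ⟩ᶠ ∣ᶠ                  ≡⟨ ∣∣ᶠ-cong (λ i → ∧-distribˡ-∨ (A i) _ _) ⟩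
    ∣ A ∩ᶠ ⁅ x ⁆ᶠ ∪ᶠ A ∩ᶠ ⟨ xs ⟩ᶠ ∣ᶠ        ≡⟨ ∣∪∣ᶠ-disjoint (λ i → ∩-disjoint (A i) (⁅⁆-⟨⟩-disjoint x∉xs i)) ⟩
    ∣ A ∩ᶠ ⁅ x ⁆ᶠ ∣ᶠ + ∣ A ∩ᶠ ⟨ xs ⟩ᶠ ∣ᶠ    ≡⟨ cong₂ _+_ (∣∩⁅⁆∣ᶠ A x) (∣∩⟨⟩∣ᶠ A xs!) ⟩
    ⟦ A x ⟧ + count A xs                     ∎
    where
    open ≡-Reasoning
    ∩-disjoint : ∀ a {b c} → b ∧ c ≡ false → (a ∧ b) ∧ (a ∧ c) ≡ false
    ∩-disjoint false _   = refl
    ∩-disjoint true  b∧c = b∧c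

-≤-⇔ : ∀ a b c e → (ℤ.+ a ℤ.- ℤ.+ b ℤ.≤ ℤ.+ c ℤ.- ℤ.+ e) ⇔ (a + e ≤ c + b)
-≤-⇔ a b c e = mk⇔
  (λ le → ≮⇒≥ λ c+b<a+e →
     ℤₚ.<⇒≱ (subst₂ ℤ._<_ right left (ℤₚ.⊖-monoˡ-< (b + e) (subst₂ _<_ (+-comm c b) (+-comm a e) c+b<a+e))) le)
  (λ le → subst₂ ℤ._≤_ left right (ℤₚ.⊖-monoˡ-≤ (b + e) (subst₂ _≤_ (+-comm a e) (+-comm c b) le)))
  where
  left : (e + a) ⊖ (b + e) ≡ ℤ.+ a ℤ.- ℤ.+ b
  left = trans (cong ((e + a) ⊖_) (+-comm b e)) (trans (ℤₚ.+-cancelˡ-⊖ e a b) (sym (ℤₚ.[+m]-[+n]≡m⊖n a b)))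
  right : (b + c) ⊖ (b + e) ≡ ℤ.+ c ℤ.- ℤ.+ e
  right = trans (ℤₚ.+-cancelˡ-⊖ b c e) (sym (ℤₚ.[+m]-[+n]≡m⊖n c e))

-≡- : ∀ a b c e → a + e ≡ c + b → ℤ.+ a ℤ.- ℤ.+ b ≡ ℤ.+ c ℤ.- ℤ.+ e
-≡- a b c e a+e≡c+b = ℤₚ.≤-antisym
  (Equivalence.from (-≤-⇔ a b c e) (≤-reflexive a+e≡c+b))
  (Equivalence.from (-≤-⇔ c e a b) (≤-reflexive (sym a+e≡c+b)))

-- Neighbourhoods and maximum independent sets

anyFin-intro : ∀ {m} (p : Fin m → Bool) i → p i ≡ true → anyFin p ≡ true
anyFin-intro p zero    pᵢ rewrite pᵢ = refl
anyFin-intro p (suc i) pᵢ rewrite anyFin-intro (p ∘ suc) i pᵢ = ∨-zeroʳ (p zero)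

anyFin-elim : ∀ {m} (p : Fin m → Bool) → anyFin p ≡ true → ∃ λ i → p i ≡ true
anyFin-elim {suc m} p any with p zero in p₀
... | true  = zero , p₀
... | false = let i , pᵢ = anyFin-elim (p ∘ suc) any in suc i , pᵢ

module _ {n : ℕ} (G : Graph n) where

  private variable
    S S₁ S₂ : Subset n
    Y Z : Subsetᶠ n
    M : List (Fin n × Fin n)

  Nᶠ : Subsetᶠ n → Subsetᶠ n
  Nᶠ Y v = anyFin (λ u → Y u ∧ adj G u v)

  lookup-N : ∀ X → lookup (N G X) ≗ Nᶠ (lookup X)
  lookup-N X = lookup∘tabulate _

  Nᶠ-intro : ∀ {u v} → u ∈ᶠ Y → adj G u v ≡ true → v ∈ᶠ Nᶠ Y
  Nᶠ-intro {u = u} {v} u∈Y u~v = anyFin-intro _ u (trans (cong (_∧ adj G u v) u∈Y) u~v)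

  Nᶠ-elim : ∀ {v} → v ∈ᶠ Nᶠ Y → ∃ λ u → u ∈ᶠ Y × adj G u v ≡ true
  Nᶠ-elim {Y} v∈NY = let u , u∈Y∧u~v = anyFin-elim _ v∈NY in
    u , ∧-conicalˡ (Y u) _ u∈Y∧u~v , ∧-conicalʳ (Y u) _ u∈Y∧u~v

  Nᶠ-mono : Y ⊆ᶠ Z → Nᶠ Y ⊆ᶠ Nᶠ Z
  Nᶠ-mono Y⊆Z v v∈NY = let u , u∈Y , u~v = Nᶠ-elim v∈NY in Nᶠ-intro (Y⊆Z u u∈Y) u~v

  Nᶠ-cong : Y ≗ Z → Nᶠ Y ≗ Nᶠ Z
  Nᶠ-cong Y≗Z = ⊆ᶠ-antisym (Nᶠ-mono (≗⇒⊆ᶠ Y≗Z)) (Nᶠ-mono (≗⇒⊆ᶠ (sym ∘ Y≗Z)))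

  Nᶠ-∪ : ∀ Y Z → Nᶠ (Y ∪ᶠ Z) ≗ Nᶠ Y ∪ᶠ Nᶠ Z
  Nᶠ-∪ Y Z = ⊆ᶠ-antisym N∪⊆∪N (∪ᶠ-⊆ (Nᶠ-mono ⊆-∪ᶠˡ) (Nᶠ-mono ⊆-∪ᶠʳ))
    where
    N∪⊆∪N : Nᶠ (Y ∪ᶠ Z) ⊆ᶠ Nᶠ Y ∪ᶠ Nᶠ Z
    N∪⊆∪N v v∈N with Nᶠ-elim v∈N
    ... | u , u∈Y∪Z , u~v with ∨-true⁻ (Y u) u∈Y∪Z
    ...   | inj₁ u∈Y = ⊆-∪ᶠˡ {A = Nᶠ Y} {B = Nᶠ Z} v (Nᶠ-intro u∈Y u~v)
    ...   | inj₂ u∈Z = ⊆-∪ᶠʳ {B = Nᶠ Z} {A = Nᶠ Y} v (Nᶠ-intro u∈Z u~v)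

  Nᶠ⁅⁆⇒adj : ∀ {a v} → v ∈ᶠ Nᶠ ⁅ a ⁆ᶠ → adj G a v ≡ true
  Nᶠ⁅⁆⇒adj {a} {v} v∈N⁅a⁆ = let u , u∈⁅a⁆ , u~v = Nᶠ-elim v∈N⁅a⁆ in subst (λ w → adj G w v ≡ true) (x∈⁅y⁆ᶠ⇒x≡y u∈⁅a⁆) u~v

  ∣N∣≡∣Nᶠ∣ᶠ : ∀ X → ∣ N G X ∣ ≡ ∣ Nᶠ (lookup X) ∣ᶠ
  ∣N∣≡∣Nᶠ∣ᶠ X = trans (∣∣≡∣lookup∣ᶠ (N G X)) (∣∣ᶠ-cong (lookup-N X))

  adj-independent : Independent G S → ∀ {u v} → u ∈ᶠ lookup S → v ∈ᶠ lookup S → adj G u v ≡ false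
  adj-independent {S} ind {u} {v} u∈S v∈S = ind u v (lookup⇒[]= u S u∈S) (lookup⇒[]= v S v∈S)

  Nᶠ-independent : Independent G S → Nᶠ (lookup S) ⊆ᶠ ∁ᶠ (lookup S)
  Nᶠ-independent {S} ind v v∈NS with lookup S v in v∈S
  ... | false = refl
  ... | true  = let u , u∈S , u~v = Nᶠ-elim v∈NS in trans (sym (adj-independent ind u∈S v∈S)) u~v

  maxIndependent-dominating : MaxIndependent G S → ∁ᶠ (lookup S) ⊆ᶠ Nᶠ (lookup S)
  maxIndependent-dominating {S} (ind , max) v v∉S with Nᶠ (lookup S) v in v∉NS
  ... | true  = refl
  ... | false = ⊥-elim (<⇒≱ (p⊂q⇒∣p∣<∣q∣ S⊂S∪v) (max (S ∪ ⁅ v ⁆) S∪v-independent))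
    where
    S⊂S∪v : S ⊂ S ∪ ⁅ v ⁆
    S⊂S∪v = p⊆p∪q ⁅ v ⁆ , v , x∈p∪q⁺ (inj₂ (x∈⁅x⁆ v)) ,
            λ v∈S → case trans (sym ([]=⇒lookup v∈S)) (Boolₚ.not-injective v∉S) of λ ()
    not-adjacent : ∀ {u} → u ∈ S → adj G u v ≡ false
    not-adjacent {u} u∈S with adj G u v in u~v
    ... | false = refl
    ... | true  = trans (sym (Nᶠ-intro ([]=⇒lookup u∈S) u~v)) v∉NS
    S∪v-independent : Independent G (S ∪ ⁅ v ⁆)
    S∪v-independent u w u∈ w∈ with x∈p∪q⁻ S ⁅ v ⁆ u∈ | x∈p∪q⁻ S ⁅ v ⁆ w∈
    ... | inj₁ u∈S | inj₁ w∈S = ind u w u∈S w∈S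
    ... | inj₁ u∈S | inj₂ w∈v rewrite x∈⁅y⁆⇒x≡y v w∈v = not-adjacent u∈S
    ... | inj₂ u∈v | inj₁ w∈S rewrite x∈⁅y⁆⇒x≡y v u∈v = trans (adj-sym G v w) (not-adjacent w∈S)
    ... | inj₂ u∈v | inj₂ w∈v rewrite x∈⁅y⁆⇒x≡y v u∈v | x∈⁅y⁆⇒x≡y v w∈v = adj-irr G v

  Nᶠ-maxIndependent : MaxIndependent G S → Nᶠ (lookup S) ≗ ∁ᶠ (lookup S)
  Nᶠ-maxIndependent mis = ⊆ᶠ-antisym (Nᶠ-independent (proj₁ mis)) (maxIndependent-dominating mis)

  ∣N∣+∣∣-maxIndependent : MaxIndependent G S → ∣ N G S ∣ + ∣ S ∣ ≡ n
  ∣N∣+∣∣-maxIndependent {S} mis = begin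
    ∣ N G S ∣ + ∣ S ∣                   ≡⟨ cong₂ _+_ (trans (∣N∣≡∣Nᶠ∣ᶠ S) (∣∣ᶠ-cong (Nᶠ-maxIndependent mis))) (∣∣≡∣lookup∣ᶠ S) ⟩
    ∣ ∁ᶠ (lookup S) ∣ᶠ + ∣ lookup S ∣ᶠ  ≡⟨ +-comm (∣ ∁ᶠ (lookup S) ∣ᶠ) (∣ lookup S ∣ᶠ) ⟩
    ∣ lookup S ∣ᶠ + ∣ ∁ᶠ (lookup S) ∣ᶠ  ≡⟨ ∣∣ᶠ+∣∁∣ᶠ (lookup S) ⟩
    n                                   ∎
    where open ≡-Reasoning

  maxIndependent-∣∣ : MaxIndependent G S₁ → MaxIndependent G S₂ → ∣ S₁ ∣ ≡ ∣ S₂ ∣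
  maxIndependent-∣∣ (ind₁ , max₁) (ind₂ , max₂) = ≤-antisym (max₂ _ ind₁) (max₁ _ ind₂)

  Nᶠ-∪-maxIndependent : MaxIndependent G S₁ → MaxIndependent G S₂ →
                        Nᶠ (lookup (S₁ ∪ S₂)) ≗ ∁ᶠ (lookup S₁ ∩ᶠ lookup S₂)
  Nᶠ-∪-maxIndependent {S₁} {S₂} mis₁ mis₂ i = begin
    Nᶠ (lookup (S₁ ∪ S₂)) i   ≡⟨ Nᶠ-cong (lookup-∪ S₁ S₂) i ⟩
    Nᶠ (s₁ ∪ᶠ s₂) i           ≡⟨ Nᶠ-∪ s₁ s₂ i ⟩
    Nᶠ s₁ i ∨ Nᶠ s₂ i         ≡⟨ cong₂ _∨_ (Nᶠ-maxIndependent mis₁ i) (Nᶠ-maxIndependent mis₂ i) ⟩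
    not (s₁ i) ∨ not (s₂ i)   ≡⟨ deMorgan₁ (s₁ i) (s₂ i) ⟨
    not (s₁ i ∧ s₂ i)         ∎
    where
    open ≡-Reasoning
    s₁ = lookup S₁
    s₂ = lookup S₂

  d-∪-maxIndependent : MaxIndependent G S₁ → MaxIndependent G S₂ → d G (S₁ ∪ S₂) ≡ d G S₁
  d-∪-maxIndependent {S₁} {S₂} mis₁ mis₂ = -≡- (∣ S₁ ∪ S₂ ∣) (∣ N G (S₁ ∪ S₂) ∣) (∣ S₁ ∣) (∣ N G S₁ ∣)
    (+-cancelʳ-≡ (c + ∣ S₁ ∣) _ _ (begin
      ∣ S₁ ∪ S₂ ∣ + ∣ N G S₁ ∣ + (c + ∣ S₁ ∣)      ≡⟨ interchange (∣ S₁ ∪ S₂ ∣) (∣ N G S₁ ∣) c (∣ S₁ ∣) ⟩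
      ∣ S₁ ∪ S₂ ∣ + c + (∣ N G S₁ ∣ + ∣ S₁ ∣)      ≡⟨ cong₂ _+_ ∣∪∣+∣∩∣ (∣N∣+∣∣-maxIndependent mis₁) ⟩
      ∣ S₁ ∣ + ∣ S₂ ∣ + n                          ≡⟨ cong₂ _+_ (cong (∣ S₁ ∣ +_) (maxIndependent-∣∣ mis₂ mis₁)) (sym ∣∩∣+∣N∪∣) ⟩
      ∣ S₁ ∣ + ∣ S₁ ∣ + (c + ∣ N G (S₁ ∪ S₂) ∣)    ≡⟨ +-shuffle (∣ S₁ ∣) c (∣ N G (S₁ ∪ S₂) ∣) ⟩
      ∣ S₁ ∣ + ∣ N G (S₁ ∪ S₂) ∣ + (c + ∣ S₁ ∣)    ∎))
    where
    open ≡-Reasoning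
    s₁ = lookup S₁
    s₂ = lookup S₂
    c = ∣ s₁ ∩ᶠ s₂ ∣ᶠ
    ∣∪∣+∣∩∣ : ∣ S₁ ∪ S₂ ∣ + c ≡ ∣ S₁ ∣ + ∣ S₂ ∣
    ∣∪∣+∣∩∣ = begin
      ∣ S₁ ∪ S₂ ∣ + c          ≡⟨ cong (_+ c) (trans (∣∣≡∣lookup∣ᶠ (S₁ ∪ S₂)) (∣∣ᶠ-cong (lookup-∪ S₁ S₂))) ⟩
      ∣ s₁ ∪ᶠ s₂ ∣ᶠ + c        ≡⟨ ∣∪∣ᶠ+∣∩∣ᶠ s₁ s₂ ⟩
      ∣ s₁ ∣ᶠ + ∣ s₂ ∣ᶠ        ≡⟨ cong₂ _+_ (∣∣≡∣lookup∣ᶠ S₁) (∣∣≡∣lookup∣ᶠ S₂) ⟨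
      ∣ S₁ ∣ + ∣ S₂ ∣          ∎
    ∣∩∣+∣N∪∣ : c + ∣ N G (S₁ ∪ S₂) ∣ ≡ n
    ∣∩∣+∣N∪∣ = trans (cong (c +_) (trans (∣N∣≡∣Nᶠ∣ᶠ (S₁ ∪ S₂)) (∣∣ᶠ-cong (Nᶠ-∪-maxIndependent mis₁ mis₂))))
                     (∣∣ᶠ+∣∁∣ᶠ (s₁ ∩ᶠ s₂))
    +-shuffle : ∀ s c m → s + s + (c + m) ≡ s + m + (c + s)
    +-shuffle = solve-∀

  independent? : ∀ S → Dec (Independent G S)
  independent? S = all? λ u → all? λ v → (u ∈? S) →-dec ((v ∈? S) →-dec (adj G u v Boolₚ.≟ false))

  maxIndependent-exists : ∃ (MaxIndependent G)
  maxIndependent-exists = grow n ∅ (λ u _ u∈∅ _ → ⊥-elim (∉⊥ u∈∅)) (m≤n+m n ∣ ∅ {n} ∣)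
    where
    grow : ∀ k S → Independent G S → n ≤ ∣ S ∣ + k → ∃ (MaxIndependent G)
    grow zero S ind n≤∣S∣+0 = S , ind , λ T _ → ≤-trans (∣p∣≤n T) (subst (n ≤_) (+-identityʳ _) n≤∣S∣+0)
    grow (suc k) S ind n≤∣S∣+k+1 with anySubset? (λ T → independent? T ×-dec (∣ S ∣ <? ∣ T ∣))
    ... | yes (T , indT , ∣S∣<∣T∣) =
      grow k T indT (≤-trans n≤∣S∣+k+1 (subst (_≤ ∣ T ∣ + k) (sym (+-suc ∣ S ∣ k)) (+-monoˡ-≤ k ∣S∣<∣T∣)))
    ... | no ∄T = S , ind , λ T indT → ≮⇒≥ λ ∣S∣<∣T∣ → ∄T (T , indT , ∣S∣<∣T∣)

  -- Matchings

  matched : List (Fin n × Fin n) → Subsetᶠ n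
  matched M = ⟨ endpoints G M ⟩ᶠ

  ∣∩matched∣ᶠ : ∀ (A : Subsetᶠ n) → Matching G M → ∣ A ∩ᶠ matched M ∣ᶠ ≡ count A (endpoints G M)
  ∣∩matched∣ᶠ A (_ , M!) = ∣∩⟨⟩∣ᶠ A M!

  count-endpoints-≤-N : ∀ Y M → Matching G M → count Y (endpoints G M) ≤ count (Nᶠ Y) (endpoints G M)
  count-endpoints-≤-N Y []            _                          = z≤n
  count-endpoints-≤-N Y ((u , v) ∷ M) (u~v ∷ edges , _ ∷ _ ∷ M!) = begin
    ⟦ Y u ⟧ + (⟦ Y v ⟧ + count Y (endpoints G M))        ≡⟨ x∙yz≈y∙xz ⟦ Y u ⟧ ⟦ Y v ⟧ _ ⟩
    ⟦ Y v ⟧ + (⟦ Y u ⟧ + count Y (endpoints G M))        ≤⟨ +-mono-≤ (⟦⟧-mono (λ v∈Y → Nᶠ-intro v∈Y v~u))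
                                                           (+-mono-≤ (⟦⟧-mono (λ u∈Y → Nᶠ-intro u∈Y u~v))
                                                             (count-endpoints-≤-N Y M (edges , M!))) ⟩
    ⟦ Nᶠ Y u ⟧ + (⟦ Nᶠ Y v ⟧ + count (Nᶠ Y) (endpoints G M)) ∎
    where
    open ≤-Reasoning
    v~u : adj G v u ≡ true
    v~u = trans (adj-sym G v u) u~v

  ∣matched∣ᶠ : Matching G M → ∣ matched M ∣ᶠ ≡ length M + length M
  ∣matched∣ᶠ {M} m = trans (∣∩matched∣ᶠ ⊤ᶠ m) (count-⊤ M)
    where
    count-⊤ : ∀ M → count ⊤ᶠ (endpoints G M) ≡ length M + length M
    count-⊤ []            = refl
    count-⊤ ((u , v) ∷ M) = cong suc (trans (cong suc (count-⊤ M)) (sym (+-suc (length M) (length M))))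

  length≤count-∁ : Independent G S → ∀ M → Matching G M → length M ≤ count (∁ᶠ (lookup S)) (endpoints G M)
  length≤count-∁     ind []            _                          = z≤n
  length≤count-∁ {S} ind ((u , v) ∷ M) (u~v ∷ edges , _ ∷ _ ∷ M!) = begin
    1 + length M                                          ≤⟨ +-mono-≤ edge-leaves-S (length≤count-∁ ind M (edges , M!)) ⟩
    ⟦ ∁S u ⟧ + ⟦ ∁S v ⟧ + count ∁S (endpoints G M)        ≡⟨ +-assoc ⟦ ∁S u ⟧ ⟦ ∁S v ⟧ _ ⟩
    ⟦ ∁S u ⟧ + (⟦ ∁S v ⟧ + count ∁S (endpoints G M))      ∎
    where
    open ≤-Reasoning
    ∁S = ∁ᶠ (lookup S)
    edge-leaves-S : 1 ≤ ⟦ ∁S u ⟧ + ⟦ ∁S v ⟧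
    edge-leaves-S with lookup S u in u∈S | lookup S v in v∈S
    ... | false | _     = s≤s z≤n
    ... | true  | false = s≤s z≤n
    ... | true  | true  = case trans (sym u~v) (adj-independent ind u∈S v∈S) of λ ()

  matching+independent≤n : Independent G S → Matching G M → length M + ∣ S ∣ ≤ n
  matching+independent≤n {S} {M} ind m = begin
    length M + ∣ S ∣                       ≤⟨ +-mono-≤ (length≤count-∁ ind M m) (≤-reflexive (∣∣≡∣lookup∣ᶠ S)) ⟩
    count ∁S (endpoints G M) + ∣ lookup S ∣ᶠ ≡⟨ cong (_+ ∣ lookup S ∣ᶠ) (∣∩matched∣ᶠ ∁S m) ⟨
    ∣ ∁S ∩ᶠ matched M ∣ᶠ + ∣ lookup S ∣ᶠ     ≤⟨ +-monoˡ-≤ (∣ lookup S ∣ᶠ) (∣∣ᶠ-mono (∩ᶠ-⊆ˡ ∁S (matched M))) ⟩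
    ∣ ∁S ∣ᶠ + ∣ lookup S ∣ᶠ                  ≡⟨ +-comm (∣ ∁S ∣ᶠ) (∣ lookup S ∣ᶠ) ⟩
    ∣ lookup S ∣ᶠ + ∣ ∁S ∣ᶠ                  ≡⟨ ∣∣ᶠ+∣∁∣ᶠ (lookup S) ⟩
    n                                       ∎
    where
    open ≤-Reasoning
    ∁S = ∁ᶠ (lookup S)

  -- Matched vertices of Y are matched into N(Y), and at most n − 2|M| vertices are unmatched.
  deficiency-bound : ∀ Y → Matching G M → ∣ Y ∣ + (length M + length M) ≤ ∣ N G Y ∣ + n
  deficiency-bound {M} Y m = begin
    ∣ Y ∣ + (length M + length M)          ≡⟨ cong₂ _+_ (trans (∣∣≡∣lookup∣ᶠ Y) (∣∣ᶠ-partition y V)) (sym (∣matched∣ᶠ m)) ⟩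
    ∣ y ∩ᶠ V ∣ᶠ + ∣ y ─ᶠ V ∣ᶠ + ∣ V ∣ᶠ        ≤⟨ +-monoˡ-≤ ∣ V ∣ᶠ (+-mono-≤ matched-part (∣∣ᶠ-mono (λ i → ∧-conicalʳ (y i) _))) ⟩
    ∣ Nᶠ y ∣ᶠ + ∣ ∁ᶠ V ∣ᶠ + ∣ V ∣ᶠ           ≡⟨ +-assoc ∣ Nᶠ y ∣ᶠ _ _ ⟩
    ∣ Nᶠ y ∣ᶠ + (∣ ∁ᶠ V ∣ᶠ + ∣ V ∣ᶠ)         ≡⟨ cong₂ _+_ (sym (∣N∣≡∣Nᶠ∣ᶠ Y)) (trans (+-comm (∣ ∁ᶠ V ∣ᶠ) (∣ V ∣ᶠ)) (∣∣ᶠ+∣∁∣ᶠ V)) ⟩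
    ∣ N G Y ∣ + n                          ∎
    where
    open ≤-Reasoning
    y = lookup Y
    V = matched M
    matched-part : ∣ y ∩ᶠ V ∣ᶠ ≤ ∣ Nᶠ y ∣ᶠ
    matched-part = begin
      ∣ y ∩ᶠ V ∣ᶠ                   ≡⟨ ∣∩matched∣ᶠ y m ⟩
      count y (endpoints G M)       ≤⟨ count-endpoints-≤-N y M m ⟩
      count (Nᶠ y) (endpoints G M)  ≡⟨ ∣∩matched∣ᶠ (Nᶠ y) m ⟨
      ∣ Nᶠ y ∩ᶠ V ∣ᶠ                 ≤⟨ ∣∣ᶠ-mono (∩ᶠ-⊆ˡ (Nᶠ y) V) ⟩
      ∣ Nᶠ y ∣ᶠ                      ∎

  endpoints-++ : ∀ M₁ M₂ → endpoints G (M₁ List.++ M₂) ≡ endpoints G M₁ List.++ endpoints G M₂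
  endpoints-++ = concatMap-++ _

  Within : Subsetᶠ n → List (Fin n × Fin n) → Set
  Within C M = All (_∈ᶠ C) (endpoints G M)

  within-mono : ∀ {C D} → C ⊆ᶠ D → Within C M → Within D M
  within-mono C⊆D = All.map (C⊆D _)

  within-++ : ∀ {M₁ M₂ C} → Within C M₁ → Within C M₂ → Within C (M₁ List.++ M₂)
  within-++ {M₁} {M₂} w₁ w₂ = subst (All _) (sym (endpoints-++ M₁ M₂)) (Allₚ.++⁺ w₁ w₂)

  matching-∷ : ∀ {C a b} → adj G a b ≡ true → Matching G M → Within C M → C a ≡ false → C b ≡ false →
               Matching G ((a , b) ∷ M)
  matching-∷ {a = a} {b} a~b (edges , M!) w Ca Cb = a~b ∷ edges , (a≢b ∷ All∈ᶠ⇒fresh w Ca) ∷ All∈ᶠ⇒fresh w Cb ∷ M!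
    where
    a≢b : a ≢ b
    a≢b refl = case trans (sym a~b) (adj-irr G a) of λ ()

  matching-++ : ∀ {M₁ M₂ C₁ C₂} → Matching G M₁ → Within C₁ M₁ → Matching G M₂ → Within C₂ M₂ →
                Disjointᶠ C₁ C₂ → Matching G (M₁ List.++ M₂)
  matching-++ {M₁} {M₂} {C₁} {C₂} (edges₁ , M₁!) w₁ (edges₂ , M₂!) w₂ C₁∩C₂≗∅ =
    Allₚ.++⁺ edges₁ edges₂ ,
    subst Unique (sym (endpoints-++ M₁ M₂)) (Uniqueₚ.++⁺ M₁! M₂! λ (x∈M₁ , x∈M₂) →
      Disjointᶠ-elim {A = C₁} {C₂} C₁∩C₂≗∅ _ (All.lookup w₁ x∈M₁) (All.lookup w₂ x∈M₂))

  -- Hall's theorem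

  HallCondition : Subsetᶠ n → Subsetᶠ n → Set
  HallCondition A B = ∀ Y → Y ⊆ᶠ A → ∣ Y ∣ᶠ ≤ ∣ B ∩ᶠ Nᶠ Y ∣ᶠ

  Saturating : Subsetᶠ n → Subsetᶠ n → List (Fin n × Fin n) → Set
  Saturating A B M = Matching G M × Within (A ∪ᶠ B) M × length M ≡ ∣ A ∣ᶠ

  Tight : Subsetᶠ n → Subsetᶠ n → Subsetᶠ n → Set
  Tight A B Y = Y ⊆ᶠ A × 0 < ∣ Y ∣ᶠ × ∣ Y ∣ᶠ < ∣ A ∣ᶠ × ∣ B ∩ᶠ Nᶠ Y ∣ᶠ ≤ ∣ Y ∣ᶠ

  tight? : ∀ A B Y → Dec (Tight A B Y)
  tight? A B Y = ⊆ᶠ? ×-dec (0 <? ∣ Y ∣ᶠ) ×-dec (∣ Y ∣ᶠ <? ∣ A ∣ᶠ) ×-dec (∣ B ∩ᶠ Nᶠ Y ∣ᶠ ≤? ∣ Y ∣ᶠ)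
    where
    ⊆ᶠ? : Dec (Y ⊆ᶠ A)
    ⊆ᶠ? = all? λ i → (Y i Boolₚ.≟ true) →-dec (A i Boolₚ.≟ true)

  Tight-cong : ∀ {A B} → Y ≗ Z → Tight A B Y → Tight A B Z
  Tight-cong {Y} {Z} {A} {B} Y≗Z (Y⊆A , ∣Y∣>0 , ∣Y∣<∣A∣ , ∣B∩NY∣≤∣Y∣) =
    ⊆ᶠ-trans (≗⇒⊆ᶠ (sym ∘ Y≗Z)) Y⊆A , subst (0 <_) ∣Y∣≡∣Z∣ ∣Y∣>0 , subst (_< ∣ A ∣ᶠ) ∣Y∣≡∣Z∣ ∣Y∣<∣A∣ ,
    subst₂ _≤_ (∣∣ᶠ-cong λ i → cong (B i ∧_) (Nᶠ-cong Y≗Z i)) ∣Y∣≡∣Z∣ ∣B∩NY∣≤∣Y∣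
    where
    ∣Y∣≡∣Z∣ = ∣∣ᶠ-cong Y≗Z

  tight-or-slack : ∀ A B → ∃ (Tight A B) ⊎ (∀ Y → ¬ Tight A B Y)
  tight-or-slack A B with anySubset? (tight? A B ∘ lookup)
  ... | yes (Y , tight) = inj₁ (lookup Y , tight)
  ... | no  ∄tight      = inj₂ λ Y tight → ∄tight (tabulate Y , Tight-cong (λ i → sym (lookup∘tabulate Y i)) tight)

  hall-restrict : ∀ {A B} → HallCondition A B → Y ⊆ᶠ A → HallCondition Y (B ∩ᶠ Nᶠ Y)
  hall-restrict {Y} {B = B} hallAB Y⊆A Z Z⊆Y = ≤-trans (hallAB Z (⊆ᶠ-trans Z⊆Y Y⊆A)) (∣∣ᶠ-mono λ v v∈B∩NZ →
    let v∈B  = ∩ᶠ-⊆ˡ B (Nᶠ Z) v v∈B∩NZ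
        v∈NZ = ∩ᶠ-⊆ʳ B (Nᶠ Z) v v∈B∩NZ
    in ∩ᶠ-intro {A = B ∩ᶠ Nᶠ Y} {Nᶠ Z} (∩ᶠ-intro {A = B} {Nᶠ Y} v∈B (Nᶠ-mono Z⊆Y v v∈NZ)) v∈NZ)

  hall-contract : ∀ {A B} → HallCondition A B → Y ⊆ᶠ A → ∣ B ∩ᶠ Nᶠ Y ∣ᶠ ≤ ∣ Y ∣ᶠ →
                  HallCondition (A ─ᶠ Y) (B ─ᶠ Nᶠ Y)
  hall-contract {Y} {A} {B} hallAB Y⊆A ∣B∩NY∣≤∣Y∣ Z Z⊆A─Y = +-cancelʳ-≤ ∣ Y ∣ᶠ _ _ (begin
    ∣ Z ∣ᶠ + ∣ Y ∣ᶠ                              ≡⟨ ∣∪∣ᶠ-disjoint {A = Z} {Y} Z∩Y≗∅ ⟨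
    ∣ Z ∪ᶠ Y ∣ᶠ                                  ≤⟨ hallAB (Z ∪ᶠ Y) (∪ᶠ-⊆ (⊆ᶠ-trans Z⊆A─Y (─ᶠ-⊆ A Y)) Y⊆A) ⟩
    ∣ B ∩ᶠ Nᶠ (Z ∪ᶠ Y) ∣ᶠ                         ≤⟨ ∣∣ᶠ-union-bound split ⟩
    ∣ (B ─ᶠ Nᶠ Y) ∩ᶠ Nᶠ Z ∣ᶠ + ∣ B ∩ᶠ Nᶠ Y ∣ᶠ       ≤⟨ +-monoʳ-≤ ∣ (B ─ᶠ Nᶠ Y) ∩ᶠ Nᶠ Z ∣ᶠ ∣B∩NY∣≤∣Y∣ ⟩
    ∣ (B ─ᶠ Nᶠ Y) ∩ᶠ Nᶠ Z ∣ᶠ + ∣ Y ∣ᶠ              ∎)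
    where
    open ≤-Reasoning
    Z∩Y≗∅ : Disjointᶠ Z Y
    Z∩Y≗∅ = Disjointᶠ-intro {A = Z} {Y} λ i i∈Z i∈Y → ∈─ᶠ⇒∉ {A = A} {Y} (Z⊆A─Y i i∈Z) i∈Y
    split : B ∩ᶠ Nᶠ (Z ∪ᶠ Y) ⊆ᶠ (B ─ᶠ Nᶠ Y) ∩ᶠ Nᶠ Z ∪ᶠ B ∩ᶠ Nᶠ Y
    split v v∈ = by-cases (B v) (Nᶠ Z v) (Nᶠ Y v) (trans (cong (B v ∧_) (sym (Nᶠ-∪ Z Y v))) v∈)
      where
      by-cases : ∀ b z y → b ∧ (z ∨ y) ≡ true → (b ∧ not y) ∧ z ∨ b ∧ y ≡ true
      by-cases true  _     true  _  = refl
      by-cases true  true  false _  = refl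
      by-cases true  false false ()
      by-cases false _     _     ()

  hall-remove-edge : ∀ {A B a} b → HallCondition A B → (∀ Y → ¬ Tight A B Y) → a ∈ᶠ A →
                     HallCondition (A ─ᶠ ⁅ a ⁆ᶠ) (B ─ᶠ ⁅ b ⁆ᶠ)
  hall-remove-edge {A} {B} {a} b hallAB ∄tight a∈A Z Z⊆A─a with ∣ Z ∣ᶠ ℕ.≟ 0
  ... | yes ∣Z∣≡0 = subst (_≤ ∣ (B ─ᶠ ⁅ b ⁆ᶠ) ∩ᶠ Nᶠ Z ∣ᶠ) (sym ∣Z∣≡0) z≤n
  ... | no  ∣Z∣≢0 = s≤s⁻¹ (begin-strict
    ∣ Z ∣ᶠ                                   <⟨ ≰⇒> (λ ∣B∩NZ∣≤∣Z∣ → ∄tight Z (Z⊆A , n≢0⇒n>0 ∣Z∣≢0 , ∣Z∣<∣A∣ , ∣B∩NZ∣≤∣Z∣)) ⟩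
    ∣ B ∩ᶠ Nᶠ Z ∣ᶠ                            ≤⟨ ∣∣ᶠ-union-bound split ⟩
    ∣ ⁅ b ⁆ᶠ ∣ᶠ + ∣ (B ─ᶠ ⁅ b ⁆ᶠ) ∩ᶠ Nᶠ Z ∣ᶠ     ≡⟨ cong (_+ ∣ (B ─ᶠ ⁅ b ⁆ᶠ) ∩ᶠ Nᶠ Z ∣ᶠ) (∣∩⁅⁆∣ᶠ ⊤ᶠ b) ⟩
    suc ∣ (B ─ᶠ ⁅ b ⁆ᶠ) ∩ᶠ Nᶠ Z ∣ᶠ             ∎)
    where
    open ≤-Reasoning
    Z⊆A : Z ⊆ᶠ A
    Z⊆A = ⊆ᶠ-trans Z⊆A─a (─ᶠ-⊆ A ⁅ a ⁆ᶠ)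
    ∣Z∣<∣A∣ : ∣ Z ∣ᶠ < ∣ A ∣ᶠ
    ∣Z∣<∣A∣ = subst (suc ∣ Z ∣ᶠ ≤_) (sym (∣∣ᶠ-remove {A = A} a∈A)) (s≤s (∣∣ᶠ-mono Z⊆A─a))
    split : B ∩ᶠ Nᶠ Z ⊆ᶠ ⁅ b ⁆ᶠ ∪ᶠ (B ─ᶠ ⁅ b ⁆ᶠ) ∩ᶠ Nᶠ Z
    split v = by-cases (B v) (Nᶠ Z v) (⁅ b ⁆ᶠ v)
      where
      by-cases : ∀ x z c → x ∧ z ≡ true → c ∨ (x ∧ not c) ∧ z ≡ true
      by-cases _     _     true  _ = refl
      by-cases true  true  false _ = refl
      by-cases true  false false ()
      by-cases false _     false ()

  saturating-++ : ∀ {A B M₁ M₂} → Y ⊆ᶠ A → Disjointᶠ A B →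
                  Saturating Y (B ∩ᶠ Nᶠ Y) M₁ → Saturating (A ─ᶠ Y) (B ─ᶠ Nᶠ Y) M₂ → Saturating A B (M₁ List.++ M₂)
  saturating-++ {Y} {A} {B} {M₁} {M₂} Y⊆A A∩B≗∅ (m₁ , w₁ , ∣M₁∣) (m₂ , w₂ , ∣M₂∣) =
    matching-++ m₁ w₁ m₂ w₂ parts-disjoint ,
    within-++ {M₁} {M₂} (within-mono {M₁} (∪ᶠ-⊆ (⊆ᶠ-trans Y⊆A (⊆-∪ᶠˡ {B = B})) (⊆ᶠ-trans (∩ᶠ-⊆ˡ B (Nᶠ Y)) (⊆-∪ᶠʳ {A = A}))) w₁)
                        (within-mono {M₂} (∪ᶠ-⊆ (⊆ᶠ-trans (─ᶠ-⊆ A Y) (⊆-∪ᶠˡ {B = B})) (⊆ᶠ-trans (─ᶠ-⊆ B (Nᶠ Y)) (⊆-∪ᶠʳ {A = A}))) w₂) ,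
    trans (length-++ M₁) (trans (cong₂ _+_ ∣M₁∣ ∣M₂∣) (sym (∣∣ᶠ-⊆-partition Y⊆A)))
    where
    parts-disjoint : Disjointᶠ (Y ∪ᶠ B ∩ᶠ Nᶠ Y) (A ─ᶠ Y ∪ᶠ B ─ᶠ Nᶠ Y)
    parts-disjoint = Disjointᶠ-intro {A = Y ∪ᶠ B ∩ᶠ Nᶠ Y} {A ─ᶠ Y ∪ᶠ B ─ᶠ Nᶠ Y} λ i i∈₁ i∈₂ →
      case ∨-true⁻ (Y i) i∈₁ , ∨-true⁻ ((A ─ᶠ Y) i) i∈₂ of λ where
        (inj₁ i∈Y    , inj₁ i∈A─Y)  → ∈─ᶠ⇒∉ {A = A} {Y} i∈A─Y i∈Y
        (inj₁ i∈Y    , inj₂ i∈B─NY) → Disjointᶠ-elim {A = A} {B} A∩B≗∅ i (Y⊆A i i∈Y) (─ᶠ-⊆ B (Nᶠ Y) i i∈B─NY)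
        (inj₂ i∈B∩NY , inj₁ i∈A─Y)  → Disjointᶠ-elim {A = A} {B} A∩B≗∅ i (─ᶠ-⊆ A Y i i∈A─Y) (∩ᶠ-⊆ˡ B (Nᶠ Y) i i∈B∩NY)
        (inj₂ i∈B∩NY , inj₂ i∈B─NY) → ∈─ᶠ⇒∉ {A = B} {Nᶠ Y} i∈B─NY (∩ᶠ-⊆ʳ B (Nᶠ Y) i i∈B∩NY)

  saturating-∷ : ∀ {A B a b} → a ∈ᶠ A → b ∈ᶠ B → adj G a b ≡ true → Disjointᶠ A B →
                 Saturating (A ─ᶠ ⁅ a ⁆ᶠ) (B ─ᶠ ⁅ b ⁆ᶠ) M → Saturating A B ((a , b) ∷ M)
  saturating-∷ {M} {A} {B} {a} {b} a∈A b∈B a~b A∩B≗∅ (m , w , ∣M∣) =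
    matching-∷ a~b m w (∉ᶠ⇒false {A = rest} a∉rest) (∉ᶠ⇒false {A = rest} b∉rest) ,
    ⊆-∪ᶠˡ {A = A} {B} a a∈A ∷ ⊆-∪ᶠʳ {B = B} {A} b b∈B ∷
      within-mono {M} (∪ᶠ-⊆ (⊆ᶠ-trans (─ᶠ-⊆ A ⁅ a ⁆ᶠ) (⊆-∪ᶠˡ {B = B})) (⊆ᶠ-trans (─ᶠ-⊆ B ⁅ b ⁆ᶠ) (⊆-∪ᶠʳ {A = A}))) w ,
    trans (cong suc ∣M∣) (sym (∣∣ᶠ-remove {A = A} a∈A))
    where
    rest = A ─ᶠ ⁅ a ⁆ᶠ ∪ᶠ B ─ᶠ ⁅ b ⁆ᶠ
    a∉rest : a ∈ᶠ rest → ⊥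
    a∉rest a∈ with ∨-true⁻ ((A ─ᶠ ⁅ a ⁆ᶠ) a) a∈
    ... | inj₁ a∈A─a = ∈─ᶠ⇒∉ {A = A} {⁅ a ⁆ᶠ} a∈A─a (x∈⁅x⁆ᶠ a)
    ... | inj₂ a∈B─b = Disjointᶠ-elim {A = A} {B} A∩B≗∅ a a∈A (─ᶠ-⊆ B ⁅ b ⁆ᶠ a a∈B─b)
    b∉rest : b ∈ᶠ rest → ⊥
    b∉rest b∈ with ∨-true⁻ ((A ─ᶠ ⁅ a ⁆ᶠ) b) b∈
    ... | inj₁ b∈A─a = Disjointᶠ-elim {A = A} {B} A∩B≗∅ b (─ᶠ-⊆ A ⁅ a ⁆ᶠ b b∈A─a) b∈B
    ... | inj₂ b∈B─b = ∈─ᶠ⇒∉ {A = B} {⁅ b ⁆ᶠ} b∈B─b (x∈⁅x⁆ᶠ b)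

  -- Induction on |A|: split along a tight set if there is one, otherwise match any a ∈ A to a
  -- neighbour b ∈ B and remove both.
  hall : ∀ {A B} → Disjointᶠ A B → HallCondition A B → ∃ (Saturating A B)
  hall {A} = hall-acc (<-wellFounded ∣ A ∣ᶠ)
    where
    hall-acc : ∀ {A B} → Acc _<_ ∣ A ∣ᶠ → Disjointᶠ A B → HallCondition A B → ∃ (Saturating A B)
    hall-acc {A} {B} (acc rec) A∩B≗∅ hallAB with ∣ A ∣ᶠ ℕ.≟ 0 | tight-or-slack A B
    ... | yes ∣A∣≡0 | _ = [] , ([] , []) , [] , sym ∣A∣≡0
    ... | no _ | inj₁ (Y , Y⊆A , ∣Y∣>0 , ∣Y∣<∣A∣ , ∣B∩NY∣≤∣Y∣) =
      let M₁ , sat₁ = hall-acc (rec ∣Y∣<∣A∣) (Disjointᶠ-mono {A = A} {B} Y⊆A (∩ᶠ-⊆ˡ B (Nᶠ Y)) A∩B≗∅)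
                        (hall-restrict hallAB Y⊆A)
          M₂ , sat₂ = hall-acc (rec ∣A─Y∣<∣A∣) (Disjointᶠ-mono {A = A} {B} (─ᶠ-⊆ A Y) (─ᶠ-⊆ B (Nᶠ Y)) A∩B≗∅)
                        (hall-contract hallAB Y⊆A ∣B∩NY∣≤∣Y∣)
      in M₁ List.++ M₂ , saturating-++ Y⊆A A∩B≗∅ sat₁ sat₂
      where
      ∣A─Y∣<∣A∣ : ∣ A ─ᶠ Y ∣ᶠ < ∣ A ∣ᶠ
      ∣A─Y∣<∣A∣ = subst (∣ A ─ᶠ Y ∣ᶠ <_) (sym (∣∣ᶠ-⊆-partition Y⊆A)) (m<n+m _ ∣Y∣>0)
    ... | no ∣A∣≢0 | inj₂ ∄tight =
      let a , a∈A          = ∣∣ᶠ-nonempty A (n≢0⇒n>0 ∣A∣≢0)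
          b , b∈B∩N⁅a⁆     = ∣∣ᶠ-nonempty (B ∩ᶠ Nᶠ ⁅ a ⁆ᶠ)
                               (subst (_≤ ∣ B ∩ᶠ Nᶠ ⁅ a ⁆ᶠ ∣ᶠ) (∣∩⁅⁆∣ᶠ ⊤ᶠ a) (hallAB ⁅ a ⁆ᶠ (⁅⁆ᶠ-⊆ a∈A)))
          b∈B              = ∩ᶠ-⊆ˡ B (Nᶠ ⁅ a ⁆ᶠ) b b∈B∩N⁅a⁆
          a~b              = Nᶠ⁅⁆⇒adj (∩ᶠ-⊆ʳ B (Nᶠ ⁅ a ⁆ᶠ) b b∈B∩N⁅a⁆)
          M , sat          = hall-acc (rec (≤-reflexive (sym (∣∣ᶠ-remove {A = A} a∈A))))
                               (Disjointᶠ-mono {A = A} {B} (─ᶠ-⊆ A ⁅ a ⁆ᶠ) (─ᶠ-⊆ B ⁅ b ⁆ᶠ) A∩B≗∅)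
                               (hall-remove-edge b hallAB ∄tight a∈A)
      in (a , b) ∷ M , saturating-∷ a∈A b∈B a~b A∩B≗∅ sat

  -- Critical maximum independent sets

  ∪-critical⇔ : MaxIndependent G S₁ → MaxIndependent G S₂ → Critical G (S₁ ∪ S₂) ⇔ Critical G S₁
  ∪-critical⇔ mis₁ mis₂ = mk⇔ (λ crit Y → subst (d G Y ℤ.≤_) d∪≡d (crit Y))
                              (λ crit Y → subst (d G Y ℤ.≤_) (sym d∪≡d) (crit Y))
    where
    d∪≡d = d-∪-maxIndependent mis₁ mis₂

  konigEgervary⇒critical : KonigEgervary G → MaxIndependent G S₁ → Critical G S₁
  konigEgervary⇒critical {S₁} (S , M , misS , (m , _) , ∣S∣+∣M∣≡n) mis₁ Y =
    Equivalence.from (-≤-⇔ (∣ Y ∣) (∣ N G Y ∣) (∣ S₁ ∣) (∣ N G S₁ ∣)) (+-cancelʳ-≤ L _ _ (begin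
      ∣ Y ∣ + ∣ N G S₁ ∣ + L    ≡⟨ trans (cong (λ k → ∣ Y ∣ + k + L) ∣NS₁∣≡L) (+-assoc (∣ Y ∣) L L) ⟩
      ∣ Y ∣ + (L + L)           ≤⟨ deficiency-bound Y m ⟩
      ∣ N G Y ∣ + n             ≡⟨ cong (∣ N G Y ∣ +_) n≡∣S₁∣+L ⟩
      ∣ N G Y ∣ + (∣ S₁ ∣ + L)  ≡⟨ trans (sym (+-assoc (∣ N G Y ∣) (∣ S₁ ∣) L)) (cong (_+ L) (+-comm (∣ N G Y ∣) (∣ S₁ ∣))) ⟩
      ∣ S₁ ∣ + ∣ N G Y ∣ + L    ∎))
    where
    open ≤-Reasoning
    L = length M
    n≡∣S₁∣+L : n ≡ ∣ S₁ ∣ + L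
    n≡∣S₁∣+L = trans (sym ∣S∣+∣M∣≡n) (cong (_+ L) (maxIndependent-∣∣ misS mis₁))
    ∣NS₁∣≡L : ∣ N G S₁ ∣ ≡ L
    ∣NS₁∣≡L = +-cancelʳ-≡ (∣ S₁ ∣) _ _ (trans (∣N∣+∣∣-maxIndependent mis₁) (trans n≡∣S₁∣+L (+-comm (∣ S₁ ∣) L)))

  critical⇒d≤ᶠ : Critical G S → ∀ Z → ∣ Z ∣ᶠ + ∣ N G S ∣ ≤ ∣ S ∣ + ∣ Nᶠ Z ∣ᶠ
  critical⇒d≤ᶠ {S} crit Z = subst₂ (λ z nz → z + ∣ N G S ∣ ≤ ∣ S ∣ + nz)
    (trans (∣∣≡∣lookup∣ᶠ T) (∣∣ᶠ-cong (lookup∘tabulate Z)))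
    (trans (∣N∣≡∣Nᶠ∣ᶠ T) (∣∣ᶠ-cong (Nᶠ-cong (lookup∘tabulate Z))))
    (Equivalence.to (-≤-⇔ (∣ T ∣) (∣ N G T ∣) (∣ S ∣) (∣ N G S ∣)) (crit T))
    where
    T = tabulate Z

  -- W = S ∖ N(Y) has no neighbour in Y, so N(W) and Y are disjoint inside N(S) = V ∖ S, and
  -- comparing d(W) ≤ d(S) leaves |Y| ≤ |S ∩ N(Y)|.
  critical⇒hall : MaxIndependent G S → Critical G S → HallCondition (∁ᶠ (lookup S)) (lookup S)
  critical⇒hall {S} mis crit Y Y⊆∁s = +-cancelˡ-≤ (∣ W ∣ᶠ + ∣ Nᶠ W ∣ᶠ) _ _ (begin
    ∣ W ∣ᶠ + ∣ Nᶠ W ∣ᶠ + ∣ Y ∣ᶠ          ≡⟨ +-assoc (∣ W ∣ᶠ) (∣ Nᶠ W ∣ᶠ) (∣ Y ∣ᶠ) ⟩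
    ∣ W ∣ᶠ + (∣ Nᶠ W ∣ᶠ + ∣ Y ∣ᶠ)        ≤⟨ +-monoʳ-≤ (∣ W ∣ᶠ) ∣NW∣+∣Y∣≤∣NS∣ ⟩
    ∣ W ∣ᶠ + ∣ N G S ∣                  ≤⟨ critical⇒d≤ᶠ {S} crit W ⟩
    ∣ S ∣ + ∣ Nᶠ W ∣ᶠ                   ≡⟨ cong (_+ ∣ Nᶠ W ∣ᶠ) (trans (∣∣≡∣lookup∣ᶠ S) (∣∣ᶠ-partition s (Nᶠ Y))) ⟩
    ∣ s ∩ᶠ Nᶠ Y ∣ᶠ + ∣ W ∣ᶠ + ∣ Nᶠ W ∣ᶠ  ≡⟨ xy∙z≈yz∙x (∣ s ∩ᶠ Nᶠ Y ∣ᶠ) (∣ W ∣ᶠ) (∣ Nᶠ W ∣ᶠ) ⟩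
    ∣ W ∣ᶠ + ∣ Nᶠ W ∣ᶠ + ∣ s ∩ᶠ Nᶠ Y ∣ᶠ  ∎)
    where
    open ≤-Reasoning
    s = lookup S
    W = s ─ᶠ Nᶠ Y
    NW∩Y≗∅ : Disjointᶠ (Nᶠ W) Y
    NW∩Y≗∅ = Disjointᶠ-intro {A = Nᶠ W} {Y} λ v v∈NW v∈Y →
      let u , u∈W , u~v = Nᶠ-elim v∈NW in
      ∈─ᶠ⇒∉ {A = s} {Nᶠ Y} u∈W (Nᶠ-intro v∈Y (trans (adj-sym G v u) u~v))
    ∣NW∣+∣Y∣≤∣NS∣ : ∣ Nᶠ W ∣ᶠ + ∣ Y ∣ᶠ ≤ ∣ N G S ∣
    ∣NW∣+∣Y∣≤∣NS∣ = begin
      ∣ Nᶠ W ∣ᶠ + ∣ Y ∣ᶠ  ≡⟨ ∣∪∣ᶠ-disjoint {A = Nᶠ W} {Y} NW∩Y≗∅ ⟨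
      ∣ Nᶠ W ∪ᶠ Y ∣ᶠ     ≤⟨ ∣∣ᶠ-mono (∪ᶠ-⊆ (Nᶠ-mono (─ᶠ-⊆ s (Nᶠ Y))) (⊆ᶠ-trans Y⊆∁s (≗⇒⊆ᶠ (sym ∘ Nᶠ-maxIndependent mis)))) ⟩
      ∣ Nᶠ s ∣ᶠ          ≡⟨ ∣N∣≡∣Nᶠ∣ᶠ S ⟨
      ∣ N G S ∣          ∎

  saturating⇒konigEgervary : MaxIndependent G S → Saturating (∁ᶠ (lookup S)) (lookup S) M → KonigEgervary G
  saturating⇒konigEgervary {S} {M} mis (m , _ , ∣M∣≡∣∁S∣) = S , M , mis , (m , maximum) , ∣S∣+∣M∣≡n
    where
    ∣S∣+∣M∣≡n : ∣ S ∣ + length M ≡ n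
    ∣S∣+∣M∣≡n = trans (cong₂ _+_ (∣∣≡∣lookup∣ᶠ S) ∣M∣≡∣∁S∣) (∣∣ᶠ+∣∁∣ᶠ (lookup S))
    maximum : ∀ M′ → Matching G M′ → length M′ ≤ length M
    maximum M′ m′ = +-cancelʳ-≤ (∣ S ∣) _ _
      (≤-trans (matching+independent≤n (proj₁ mis) m′) (≤-reflexive (trans (sym ∣S∣+∣M∣≡n) (+-comm (∣ S ∣) (length M)))))

  critical⇒konigEgervary : MaxIndependent G S → Critical G S → KonigEgervary G
  critical⇒konigEgervary {S} mis crit =
    let _ , saturating = hall {∁ᶠ (lookup S)} (λ i → ∧-inverseˡ (lookup S i)) (critical⇒hall mis crit)
    in saturating⇒konigEgervary mis saturating

corollary3p8 : ∀ {n : ℕ} (G : Graph n) →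
    (KonigEgervary G → ∀ S₁ S₂ → MaxIndependent G S₁ → MaxIndependent G S₂ → Critical G (S₁ ∪ S₂))
    × ((∀ S₁ S₂ → MaxIndependent G S₁ → MaxIndependent G S₂ → Critical G (S₁ ∪ S₂))
        → Σ (Subset n) (λ S₁ → Σ (Subset n) (λ S₂ → MaxIndependent G S₁ × MaxIndependent G S₂ × Critical G (S₁ ∪ S₂))))
    × (Σ (Subset n) (λ S₁ → Σ (Subset n) (λ S₂ → MaxIndependent G S₁ × MaxIndependent G S₂ × Critical G (S₁ ∪ S₂)))
        → KonigEgervary G)
corollary3p8 G =
    (λ ke S₁ S₂ mis₁ mis₂ → Equivalence.from (∪-critical⇔ G mis₁ mis₂) (konigEgervary⇒critical G ke mis₁))
  , (λ all-critical → let S , mis = maxIndependent-exists G in S , S , mis , mis , all-critical S S mis mis)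
  , (λ (S₁ , S₂ , mis₁ , mis₂ , crit) → critical⇒konigEgervary G mis₁ (Equivalence.to (∪-critical⇔ G mis₁ mis₂) crit))
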